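{- Let $\pi$ be a permutation and $V$ a set of points in the plot of $\pi$. Then there is at most one valid hook configuration on $\pi$ whose set of northeast endpoints is exactly $V$.
   Context: For $\pi\in S_n$, its plot is $\{(i,\pi_i):i\in[n]\}$. $(i,\pi_i)$ is a descent top if $i<n$ and $\pi_i>\pi_{i+1}$. A hook from $(i,\pi_i)$ to $(j,\pi_j)$, defined when $i<j$ and $\pi_i<\pi_j$, is the union of the vertical segment from $(i,\pi_i)$ to $(i,\pi_j)$ and the horizontal segment from $(i,\pi_j)$ to $(j,\pi_j)$; $(i,\pi_i)$ is the southwest endpoint, $(j,\pi_j)$ the northeast endpoint. A valid hook configuration on $\pi$ is a set of hooks such that (i) the set of southwest endpoints is exactly the set of descent tops; (ii) no point of the plot lies above a hook, i.e. for a hook from $(i,\pi_i)$ to $(j,\pi_j)$ there is no $k$ with $i<k<j$ and $\pi_k>\pi_j$; (iii) hooks do not intersect each other except at their endpoints. -}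

module Defs where

open import Data.Nat using (ℕ; suc; _≤_; _<_)
open import Data.Fin using (Fin; toℕ)
open import Data.Fin.Permutation using (Permutation′; _⟨$⟩ʳ_)
open import Data.Bool using (Bool; true)
open import Data.Product using (Σ; ∃; _×_)
open import Data.Sum using (_⊎_)
open import Relation.Nullary using (¬_)
open import Relation.Binary.PropositionalEquality using (_≡_)
open import Function.Bundles using (_⇔_)

-- A point of the plot of π is identified with its position i : Fin n; it is
-- the lattice point (toℕ i , toℕ (π i)).
module _ {n : ℕ} (π : Permutation′ n) where

  val : Fin n → ℕ
  val i = toℕ (π ⟨$⟩ʳ i)

  IsDescentTop : Fin n → Set
  IsDescentTop i = Σ (Fin n) λ k → (toℕ k ≡ suc (toℕ i)) × (val k < val i)

  IsHook : Fin n → Fin n → Set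
  IsHook i j = (toℕ i < toℕ j) × (val i < val j)

  OnHook : Fin n → Fin n → ℕ → ℕ → Set
  OnHook i j x y =
    ((x ≡ toℕ i) × (val i ≤ y) × (y ≤ val j))
    ⊎ ((y ≡ val j) × (toℕ i ≤ x) × (x ≤ toℕ j))

  IsEndpoint : Fin n → Fin n → ℕ → ℕ → Set
  IsEndpoint i j x y =
    ((x ≡ toℕ i) × (y ≡ val i)) ⊎ ((x ≡ toℕ j) × (y ≡ val j))

  -- A set of hooks is encoded by its characteristic function
  -- H i j ≡ true  iff  the hook from (i,π_i) to (j,π_j) belongs to the set.
  HookSet : Set
  HookSet = Fin n → Fin n → Bool

  record ValidHookConfiguration (H : HookSet) : Set where
    field
      hooks       : ∀ i j → H i j ≡ true → IsHook i j
      southwest   : ∀ i → (∃ λ j → H i j ≡ true) ⇔ IsDescentTop i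
      notAbove    : ∀ i j k → H i j ≡ true →
                    toℕ i < toℕ k → toℕ k < toℕ j → ¬ (val j < val k)
      -- (iii) distinct hooks meet only at (common) endpoints.
      -- (Hooks lie on integer grid lines with integer endpoints, so it
      -- suffices to test lattice points.)
      noCrossing  : ∀ i j i' j' → H i j ≡ true → H i' j' ≡ true →
                    ¬ ((i ≡ i') × (j ≡ j')) →
                    ∀ x y → OnHook i j x y → OnHook i' j' x y →
                    IsEndpoint i j x y × IsEndpoint i' j' x y

  NortheastSetIs : HookSet → (Fin n → Set) → Set
  NortheastSetIs H V = ∀ j → (∃ λ i → H i j ≡ true) ⇔ V j

module Submission where

-- Let A and B be valid hook configurations on π with the same set V of
-- northeast endpoints; both start their hooks exactly at the descent tops.
-- We show that every hook i→j of A is a hook of B, by induction on the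
-- horizontal length of the hook; by symmetry A = B.  Since i is a descent
-- top, B has some hook i→j′.  If j′ < j, then j′ ∈ V gives a hook a→j′ of
-- A, and each position of a relative to i contradicts the geometry of A or,
-- via the induction hypothesis, of B.  If j′ > j, then j ∈ V gives a hook
-- i″→j of B, and the case i″ > i produces a shorter hook of A starting at
-- i″ to which the induction hypothesis applies.
-- The geometric input, established first for a single configuration, is:
-- at most one hook leaves / enters each point, and a hook starting strictly
-- inside another hook's horizontal range also ends strictly inside it.

open import Defs
open import Data.Nat using (ℕ; zero; suc; _+_; _≤_; _<_; s≤s; _⊔_)
open import Data.Nat.Properties
  using (<-cmp; <-irrefl; <-asym; ≤-trans; <⇒≤; n≤1+n; m≤m+n; +-monoʳ-≤;
         ≮⇒≥; ≰⇒>; ≤∧≢⇒<; m≤m⊔n; m≤n⊔m; ⊔-lub; 1+n≢n)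
open import Data.Fin using (Fin; toℕ; _≟_)
open import Data.Fin.Properties using (toℕ-injective)
open import Data.Fin.Permutation using (Permutation′)
open import Function.Bundles using (Injection; Equivalence)
open import Function.Properties.Inverse using (↔⇒↣)
open import Data.Bool using (Bool; true; false)
open import Data.Product using (∃; _×_; _,_; proj₁; proj₂)
open import Data.Sum using (inj₁; inj₂)
open import Data.Empty using (⊥; ⊥-elim)
open import Relation.Nullary using (¬_; yes; no)
open import Relation.Binary using (tri<; tri≈; tri>)
open import Relation.Binary.PropositionalEquality
  using (_≡_; _≢_; refl; sym; cong; subst)

true-equiv⇒≡ : ∀ {a b : Bool} →
  (a ≡ true → b ≡ true) → (b ≡ true → a ≡ true) → a ≡ b
true-equiv⇒≡ {false} {false} _ _   = refl
true-equiv⇒≡ {false} {true}  _ b⇒a = b⇒a refl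
true-equiv⇒≡ {true}          a⇒b _ = sym (a⇒b refl)

-- If j′ < j ≤ i + (d + 1) and i ≤ a, then j′ ≤ a + d: a hook from a to j′
-- is strictly shorter than the length bound d + 1 for a hook from i to j.
shorter : ∀ {d i j j′ a} → j′ < j → j ≤ suc d + i → i ≤ a → j′ ≤ d + a
shorter {d} (s≤s j′≤j) (s≤s j≤d+i) i≤a =
  ≤-trans j′≤j (≤-trans j≤d+i (+-monoʳ-≤ d i≤a))

module _ {n : ℕ} (π : Permutation′ n) where

  val-injective : ∀ {a b} → val π a ≡ val π b → a ≡ b
  val-injective e = Injection.injective (↔⇒↣ π) (toℕ-injective e)

  -- Hooks leave exactly the descent tops, so if one configuration has a hook
  -- leaving i, so does any other.
  out-transfer : ∀ {H H′} →
    ValidHookConfiguration π H → ValidHookConfiguration π H′ →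
    ∀ {i j} → H i j ≡ true → ∃ λ j′ → H′ i j′ ≡ true
  out-transfer C C′ {i} {j} h =
    Equivalence.from (southwest C′ i) (Equivalence.to (southwest C i) (j , h))
    where open ValidHookConfiguration

  in-transfer : ∀ {H H′ V} →
    NortheastSetIs π H V → NortheastSetIs π H′ V →
    ∀ {i j} → H i j ≡ true → ∃ λ i′ → H′ i′ j ≡ true
  in-transfer N N′ {i} {j} h = Equivalence.from (N′ j) (Equivalence.to (N j) (i , h))

  module Configuration {H : HookSet π} (C : ValidHookConfiguration π H) where
    open ValidHookConfiguration C

    shared-point-is-endpoint : ∀ {i j i′ j′} →
      H i j ≡ true → H i′ j′ ≡ true → ¬ ((i ≡ i′) × (j ≡ j′)) →
      ∀ {x y} → OnHook π i j x y → OnHook π i′ j′ x y → IsEndpoint π i j x y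
    shared-point-is-endpoint h h′ distinct p p′ =
      proj₁ (noCrossing _ _ _ _ h h′ distinct _ _ p p′)

    -- At most one hook leaves a point: two hooks from i would share the
    -- point (i, π_i + 1) on their vertical segments.
    out-unique : ∀ {i j j′} → H i j ≡ true → H i j′ ≡ true → j ≡ j′
    out-unique {i} {j} {j′} h h′ with j ≟ j′
    ... | yes j≡j′ = j≡j′
    ... | no j≢j′ with shared-point-is-endpoint h h′ (λ p → j≢j′ (proj₂ p))
                         (inj₁ (refl , n≤1+n _ , proj₂ (hooks i j h)))
                         (inj₁ (refl , n≤1+n _ , proj₂ (hooks i j′ h′)))
    ...   | inj₁ (_ , 1+vi≡vi) = ⊥-elim (1+n≢n 1+vi≡vi)
    ...   | inj₂ (i≡j , _)     = ⊥-elim (<-irrefl i≡j (proj₁ (hooks i j h)))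

    -- At most one hook enters a point: two hooks into j would share the
    -- point (max(i, i′), π_j) on their horizontal segments.
    in-unique : ∀ {i i′ j} → H i j ≡ true → H i′ j ≡ true → i ≡ i′
    in-unique {i} {i′} {j} h h′ with i ≟ i′
    ... | yes i≡i′ = i≡i′
    ... | no i≢i′ with ⊔-lub (proj₁ (hooks i j h)) (proj₁ (hooks i′ j h′))
    ...   | max<j with shared-point-is-endpoint h h′ (λ p → i≢i′ (proj₁ p))
                         (inj₂ (refl , m≤m⊔n _ _ , <⇒≤ max<j))
                         (inj₂ (refl , m≤n⊔m _ _ , <⇒≤ max<j))
    ...     | inj₁ (_ , vj≡vi)   = ⊥-elim (<-irrefl (sym vj≡vi) (proj₂ (hooks i j h)))
    ...     | inj₂ (max≡j , _)   = ⊥-elim (<-irrefl max≡j max<j)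

    below-hook : ∀ {i j k} → H i j ≡ true →
      toℕ i < toℕ k → toℕ k < toℕ j → val π k < val π j
    below-hook h i<k k<j =
      ≤∧≢⇒< (≮⇒≥ (notAbove _ _ _ h i<k k<j))
            (λ vk≡vj → <-irrefl (cong toℕ (val-injective vk≡vj)) k<j)

    nested : ∀ {i j a b} → H i j ≡ true → H a b ≡ true →
      toℕ i < toℕ a → toℕ a < toℕ j → toℕ b < toℕ j
    nested {i} {j} {a} {b} h h′ i<a a<j = ≤∧≢⇒< (≮⇒≥ j≮b) b≢j
      where
      -- otherwise the vertical segment of a→b crosses the horizontal
      -- segment of i→j at (a, π_j), which is not an endpoint of i→j
      crossing : ¬ (val π j ≤ val π b)
      crossing vj≤vb with shared-point-is-endpoint h h′
                            (λ p → <-irrefl (cong toℕ (proj₁ p)) i<a)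
                            (inj₂ (refl , <⇒≤ i<a , <⇒≤ a<j))
                            (inj₁ (refl , <⇒≤ (below-hook h i<a a<j) , vj≤vb))
      ... | inj₁ (a≡i , _) = <-irrefl (sym a≡i) i<a
      ... | inj₂ (a≡j , _) = <-irrefl a≡j a<j

      vb<vj : val π b < val π j
      vb<vj = ≰⇒> crossing

      j≮b : ¬ (toℕ j < toℕ b)
      j≮b j<b = notAbove a b j h′ a<j j<b vb<vj

      b≢j : toℕ b ≢ toℕ j
      b≢j b≡j = <-irrefl (cong (val π) (toℕ-injective b≡j)) vb<vj

  module Uniqueness {V : Fin n → Set} {A B : HookSet π}
    (CA : ValidHookConfiguration π A) (NA : NortheastSetIs π A V)
    (CB : ValidHookConfiguration π B) (NB : NortheastSetIs π B V) where
    module A = Configuration CA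
    module B = Configuration CB
    open ValidHookConfiguration using (hooks)

    HooksUpTo : ℕ → Set
    HooksUpTo d = ∀ i j → toℕ j ≤ d + toℕ i → A i j ≡ true → B i j ≡ true

    -- B has no hook i→j′ shorter than a hook i→j of A: j′ ∈ V gives a hook
    -- a→j′ of A; a = i breaks out-uniqueness in A, a < i makes i→j nest in
    -- a→j′, and a > i gives (by induction) a second hook into j′ in B.
    no-shorter-in-B : ∀ {d i j j′} → HooksUpTo d → toℕ j ≤ suc d + toℕ i →
      A i j ≡ true → B i j′ ≡ true → toℕ j′ < toℕ j → ⊥
    no-shorter-in-B {i = i} {j′ = j′} ih len h h′ j′<j with in-transfer NB NA h′
    ... | a , ha with <-cmp (toℕ a) (toℕ i)
    ... | tri≈ _ a≡i _ =
      <-irrefl (cong toℕ (A.out-unique (subst (λ z → A z j′ ≡ true) (toℕ-injective a≡i) ha) h)) j′<j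
    ... | tri< a<i _ _ = <-asym j′<j (A.nested ha h a<i (proj₁ (hooks CB i j′ h′)))
    ... | tri> _ _ i<a =
      <-irrefl (cong toℕ (B.in-unique h′ (ih a j′ (shorter j′<j len (<⇒≤ i<a)) ha))) i<a

    -- B has no hook i→j′ longer than a hook i→j of A: j ∈ V gives a hook
    -- i″→j of B; i″ = i breaks out-uniqueness in B, i″ < i makes i→j′ nest
    -- in i″→j, and for i″ > i the descent top i″ starts a hook i″→b of A
    -- nested in i→j, which by induction is a second hook leaving i″ in B.
    no-longer-in-B : ∀ {d i j j′} → HooksUpTo d → toℕ j ≤ suc d + toℕ i →
      A i j ≡ true → B i j′ ≡ true → toℕ j < toℕ j′ → ⊥
    no-longer-in-B {i = i} {j = j} ih len h h′ j<j′ with in-transfer NA NB h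
    ... | i″ , hi″ with <-cmp (toℕ i″) (toℕ i)
    ... | tri≈ _ i″≡i _ =
      <-irrefl (cong toℕ (B.out-unique (subst (λ z → B z j ≡ true) (toℕ-injective i″≡i) hi″) h′)) j<j′
    ... | tri< i″<i _ _ = <-asym j<j′ (B.nested hi″ h′ i″<i (proj₁ (hooks CA i j h)))
    ... | tri> _ _ i<i″ with out-transfer CB CA hi″
    ...   | b , hb = <-irrefl (cong toℕ (B.out-unique hb′ hi″)) b<j
      where
      b<j : toℕ b < toℕ j
      b<j = A.nested h hb i<i″ (proj₁ (hooks CB i″ j hi″))

      hb′ : B i″ b ≡ true
      hb′ = ih i″ b (shorter b<j len (<⇒≤ i<i″)) hb

    -- Induction on the length: B's hook leaving i can be neither shorter nor
    -- longer than A's.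
    hooks-up-to : ∀ d → HooksUpTo d
    hooks-up-to zero i j len h =
      ⊥-elim (<-irrefl refl (≤-trans (proj₁ (hooks CA i j h)) len))
    hooks-up-to (suc d) i j len h with out-transfer CA CB h
    ... | j′ , h′ with <-cmp (toℕ j′) (toℕ j)
    ... | tri≈ _ j′≡j _ = subst (λ z → B i z ≡ true) (toℕ-injective j′≡j) h′
    ... | tri< j′<j _ _ = ⊥-elim (no-shorter-in-B (hooks-up-to d) len h h′ j′<j)
    ... | tri> _ _ j<j′ = ⊥-elim (no-longer-in-B (hooks-up-to d) len h h′ j<j′)

    A⊆B : ∀ i j → A i j ≡ true → B i j ≡ true
    A⊆B i j = hooks-up-to (toℕ j) i j (m≤m+n _ _)

proposition2p2 : (n : ℕ) (π : Permutation′ n) (V : Fin n → Set)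
    (H H′ : HookSet π) →
    ValidHookConfiguration π H → NortheastSetIs π H V →
    ValidHookConfiguration π H′ → NortheastSetIs π H′ V →
    ∀ i j → H i j ≡ H′ i j
proposition2p2 n π V H H′ C N C′ N′ i j =
  true-equiv⇒≡ (Uniqueness.A⊆B π C N C′ N′ i j) (Uniqueness.A⊆B π C′ N′ C N i j)
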